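{- Assume $5\nmid n$. Let $u$ and $t$ be integers with $5u\equiv1\pmod{\Delta_n}$ and $$t\equiv(n^2+3n+4)(11n^5+110n^4+440n^3+903n^2+940n+390)\Delta_n-un^2(11n^3+55n^2+110n+199)\delta_n^2\pmod{\Delta_n\delta_n^2}.$$ Then $t\equiv-un^2\pmod{\Delta_n}$ and $t\equiv-(n^2+3n+4)\pmod{\delta_n^2}$.
   Context: $n$ is an integer, $\delta_n=n^3+5n^2+10n+7$, $\Delta_n=n^4+5n^3+15n^2+25n+25$. -}

module Defs where

open import Data.Integer using (ℤ; _+_; _*_; _-_; -_; +_)
open import Data.Integer.Divisibility using (_∣_)

δ : ℤ → ℤ
δ n = n * n * n + + 5 * (n * n) + + 10 * n + + 7

Δ : ℤ → ℤ
Δ n = n * n * n * n + + 5 * (n * n * n) + + 15 * (n * n) + + 25 * n + + 25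

_≡_[mod_] : ℤ → ℤ → ℤ → Set
a ≡ b [mod m ] = m ∣ (a - b)

-- With Δ-cofactor and δ²-cofactor below one has the Bézout identity
-- δ²-cofactor · δ² − Δ-cofactor · Δ = 1 in ℤ[n]. Hence the two summands of the
-- right-hand side are, up to sign, the CRT idempotents for the coprime moduli Δ
-- and δ², and reducing modulo each factor leaves −u n² and −(n² + 3n + 4).
module Submission where

open import Defs
open import Data.Integer using (ℤ; _+_; _*_; _-_; -_; +_)
open import Data.Integer.Divisibility using (_∣_)
import Data.Integer.Divisibility.Signed as Signed
open import Data.Integer.Properties using (+-minus-telescope; +-identityʳ; *-zeroʳ)
open import Data.Integer.Tactic.RingSolver using (solve-∀)
open import Data.Product using (_×_; _,_)
open import Relation.Nullary using (¬_)
open import Relation.Binary.PropositionalEquality using (_≡_; cong; subst; module ≡-Reasoning)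

≡-mod-trans : ∀ {m a b c} → a ≡ b [mod m ] → b ≡ c [mod m ] → a ≡ c [mod m ]
≡-mod-trans {m} {a} {b} {c} a≡b b≡c = Signed.∣⇒∣ᵤ
  (subst (m Signed.∣_) (+-minus-telescope a b c)
    (Signed.∣m∣n⇒∣m+n {m} {a - b} {b - c} (Signed.∣ᵤ⇒∣ a≡b) (Signed.∣ᵤ⇒∣ b≡c)))

≡-mod-*ʳ⇒≡-mod : ∀ {m k a b} → a ≡ b [mod m * k ] → a ≡ b [mod m ]
≡-mod-*ʳ⇒≡-mod {m} {k} {a} {b} a≡b = Signed.∣⇒∣ᵤ
  (Signed.∣-trans (Signed.∣m⇒∣m*n k (Signed.∣-refl {m})) (Signed.∣ᵤ⇒∣ {m * k} {a - b} a≡b))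

≡-mod-*ˡ⇒≡-mod : ∀ {m k a b} → a ≡ b [mod m * k ] → a ≡ b [mod k ]
≡-mod-*ˡ⇒≡-mod {m} {k} {a} {b} a≡b = Signed.∣⇒∣ᵤ
  (Signed.∣-trans (Signed.∣n⇒∣m*n m (Signed.∣-refl {k})) (Signed.∣ᵤ⇒∣ {m * k} {a - b} a≡b))

module CRT {A B F G : ℤ} (bézout : G * B - F * A ≡ + 1) (p q : ℤ) where
  open ≡-Reasoning

  *-[1-bézout]≡0 : ∀ x → x * (+ 1 - (G * B - F * A)) ≡ + 0
  *-[1-bézout]≡0 x = begin
    x * (+ 1 - (G * B - F * A)) ≡⟨ cong (λ e → x * (+ 1 - e)) bézout ⟩
    x * + 0                     ≡⟨ *-zeroʳ x ⟩
    + 0                         ∎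

  -- _≡_[mod_] has default precedence 20, tighter than _-_.
  crt-≡-mod-left : (p * F * A - q * G * B) ≡ - q [mod A ]
  crt-≡-mod-left = Signed.∣⇒∣ᵤ (Signed.divides ((p - q) * F) (begin
    p * F * A - q * G * B - - q                     ≡⟨ expand p q F A G B ⟩
    (p - q) * F * A + q * (+ 1 - (G * B - F * A))   ≡⟨ cong (_+_ ((p - q) * F * A)) (*-[1-bézout]≡0 q) ⟩
    (p - q) * F * A + + 0                           ≡⟨ +-identityʳ _ ⟩
    (p - q) * F * A                                 ∎))
    where
    expand : ∀ p q F A G B → p * F * A - q * G * B - - q ≡ (p - q) * F * A + q * (+ 1 - (G * B - F * A))
    expand = solve-∀

  crt-≡-mod-right : (p * F * A - q * G * B) ≡ - p [mod B ]
  crt-≡-mod-right = Signed.∣⇒∣ᵤ (Signed.divides ((p - q) * G) (begin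
    p * F * A - q * G * B - - p                     ≡⟨ expand p q F A G B ⟩
    (p - q) * G * B + p * (+ 1 - (G * B - F * A))   ≡⟨ cong (_+_ ((p - q) * G * B)) (*-[1-bézout]≡0 p) ⟩
    (p - q) * G * B + + 0                           ≡⟨ +-identityʳ _ ⟩
    (p - q) * G * B                                 ∎))
    where
    expand : ∀ p q F A G B → p * F * A - q * G * B - - p ≡ (p - q) * G * B + p * (+ 1 - (G * B - F * A))
    expand = solve-∀

Δ-cofactor : ℤ → ℤ
Δ-cofactor n = + 11 * (n * n * n * n * n) + + 110 * (n * n * n * n) + + 440 * (n * n * n) + + 903 * (n * n) + + 940 * n + + 390

δ²-cofactor : ℤ → ℤ
δ²-cofactor n = + 11 * (n * n * n) + + 55 * (n * n) + + 110 * n + + 199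

δ²-Δ-bézout : ∀ n → δ²-cofactor n * (δ n * δ n) - Δ-cofactor n * Δ n ≡ + 1
δ²-Δ-bézout = expanded
  where
  -- solve-∀ treats δ, Δ and the cofactors as opaque, so they are spelled out.
  expanded : ∀ n →
    (+ 11 * (n * n * n) + + 55 * (n * n) + + 110 * n + + 199) * ((n * n * n + + 5 * (n * n) + + 10 * n + + 7) * (n * n * n + + 5 * (n * n) + + 10 * n + + 7))
    - (+ 11 * (n * n * n * n * n) + + 110 * (n * n * n * n) + + 440 * (n * n * n) + + 903 * (n * n) + + 940 * n + + 390)
      * (n * n * n * n + + 5 * (n * n * n) + + 15 * (n * n) + + 25 * n + + 25)
    ≡ + 1
  expanded = solve-∀

lemma2p4 : (n u t : ℤ) → ¬ (+ 5 ∣ n) →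
    (+ 5 * u) ≡ + 1 [mod Δ n ] →
    t ≡ (n * n + + 3 * n + + 4)
          * (+ 11 * (n * n * n * n * n) + + 110 * (n * n * n * n) + + 440 * (n * n * n) + + 903 * (n * n) + + 940 * n + + 390)
          * Δ n
        - u * (n * n) * (+ 11 * (n * n * n) + + 55 * (n * n) + + 110 * n + + 199) * (δ n * δ n)
        [mod Δ n * (δ n * δ n) ] →
    (t ≡ - (u * (n * n)) [mod Δ n ]) × (t ≡ - (n * n + + 3 * n + + 4) [mod δ n * δ n ])
-- The congruence unfolds to divisibility of absolute values, which blocks
-- unification, so the moduli and sides are given explicitly.
lemma2p4 n u t _ _ t≡T =
    ≡-mod-trans {Δ n} {t} {T} (≡-mod-*ʳ⇒≡-mod {Δ n} {δ n * δ n} {t} {T} t≡T) crt-≡-mod-left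
  , ≡-mod-trans {δ n * δ n} {t} {T} (≡-mod-*ˡ⇒≡-mod {Δ n} {δ n * δ n} {t} {T} t≡T) crt-≡-mod-right
  where
  p q T : ℤ
  p = n * n + + 3 * n + + 4
  q = u * (n * n)
  T = p * Δ-cofactor n * Δ n - q * δ²-cofactor n * (δ n * δ n)
  open CRT {Δ n} {δ n * δ n} {Δ-cofactor n} {δ²-cofactor n} (δ²-Δ-bézout n) p q
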